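{- Let $u_0=[1,-1]$. Then (1) for every $k\ge4$, $OR_k\le^{acyc}_{con}\{OR_2,XOR,u_0\}$; and (2) for every $k\ge2$, $NAND_k\le^{acyc}_{con}\{OR_2,XOR,u_0\}$.
   Context: Constraint functions are $f:\{0,1\}^k\to\mathbb{C}$; symmetric functions are written $[a_0,\dots,a_k]$ ($a_i$ = value on inputs with exactly $i$ ones). $u_0(0)=1$, $u_0(1)=-1$; $OR_k=[0,1,\dots,1]$; $NAND_k=[1,\dots,1,0]$; $XOR=[0,1,0]$. A hypergraph is acyclic if repeatedly deleting vertices lying in at most one hyperedge and deleting hyperedges empty or contained in another yields the empty hypergraph. $f\le^{acyc}_{con}\mathcal{G}$ ($f$ of arity $k$ on $x_1,\dots,x_k$) means: there exist $\lambda\ne0$, auxiliary variables $y_1,\dots,y_m$ and finitely many constraints $(g_j,(z^j_1,\dots,z^j_{d_j}))$, $g_j\in\mathcal{G}$, $z^j_\ell\in\{x_1,\dots,x_k,y_1,\dots,y_m\}$, whose hypergraph (vertices $x$'s and $y$'s, hyperedges $\{z^j_1,\dots,z^j_{d_j}\}$) is acyclic, with $f(x)=\lambda\sum_{y\in\{0,1\}^m}\prod_j g_j(z^j_1,\dots,z^j_{d_j})$ for all $x$. -}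

module Defs where

open import Data.Nat as ℕ using (ℕ; zero; suc; _≤_; _≡ᵇ_)
open import Data.Bool using (Bool; true; false; if_then_else_)
open import Data.Fin using (Fin; zero; suc)
open import Data.Fin.Subset using (Subset; ⊥; ⊤; ⁅_⁆; _∪_; _-_; _⊆_)
open import Data.Fin.Subset.Properties using (_∈?_)
open import Data.List using (List; []; _∷_; length; filter; removeAt; lookup)
open import Data.Product using (Σ; ∃; _×_; _,_)
open import Data.Sum using (_⊎_)
open import Data.Vec.Functional using (_++_)
open import Data.Rational using (ℚ; 0ℚ; 1ℚ; -_; _+_; _*_)
open import Relation.Binary.PropositionalEquality using (_≡_; _≢_)
open import Relation.Binary.Construct.Closure.ReflexiveTransitive using (Star)

Fn : ℕ → Set
Fn k = (Fin k → Bool) → ℚ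

ones : ∀ {k} → (Fin k → Bool) → ℕ
ones {zero}  x = 0
ones {suc k} x = (if x zero then 1 else 0) ℕ.+ ones (λ i → x (suc i))

OR : (k : ℕ) → Fn k
OR k x = if ones x ≡ᵇ 0 then 0ℚ else 1ℚ

NAND : (k : ℕ) → Fn k
NAND k x = if ones x ≡ᵇ k then 0ℚ else 1ℚ

XOR : Fn 2
XOR x = if ones x ≡ᵇ 1 then 1ℚ else 0ℚ

u0 : Fn 1
u0 x = if x zero then - 1ℚ else 1ℚ

record Hypergraph (n : ℕ) : Set where
  constructor hg
  field
    verts : Subset n
    edges : List (Subset n)

degree : ∀ {n} → Fin n → List (Subset n) → ℕ
degree v E = length (filter (v ∈?_) E)

removeVertex : ∀ {n} → Fin n → List (Subset n) → List (Subset n)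
removeVertex v []      = []
removeVertex v (e ∷ E) = (e - v) ∷ removeVertex v E

data Step {n : ℕ} : Hypergraph n → Hypergraph n → Set where
  delVertex : ∀ {V E} (v : Fin n) → v Data.Fin.Subset.∈ V → degree v E ≤ 1 →
              Step (hg V E) (hg (V - v) (removeVertex v E))
  delEmpty  : ∀ {V E} (i : Fin (length E)) → lookup E i ≡ ⊥ →
              Step (hg V E) (hg V (removeAt E i))
  delSub    : ∀ {V E} (i j : Fin (length E)) → i ≢ j → lookup E i ⊆ lookup E j →
              Step (hg V E) (hg V (removeAt E i))

Acyclic : ∀ {n} → Hypergraph n → Set
Acyclic H = Star Step H (hg ⊥ [])

record ConstraintSet : Set₁ where
  field
    Idx : Set
    arity : Idx → ℕ
    fn : (i : Idx) → Fn (arity i)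

record Constraint (𝒢 : ConstraintSet) (n : ℕ) : Set where
  constructor con
  open ConstraintSet 𝒢
  field
    g : Idx
    scope : Fin (arity g) → Fin n

scopeSet : ∀ {d n} → (Fin d → Fin n) → Subset n
scopeSet {zero}  s = ⊥
scopeSet {suc d} s = ⁅ s zero ⁆ ∪ scopeSet (λ i → s (suc i))

hyperedges : ∀ {𝒢 n} → List (Constraint 𝒢 n) → List (Subset n)
hyperedges []                = []
hyperedges (con g s ∷ cs)    = scopeSet s ∷ hyperedges cs

hypergraphOf : ∀ {𝒢 n} → List (Constraint 𝒢 n) → Hypergraph n
hypergraphOf cs = hg ⊤ (hyperedges cs)

evalAll : ∀ {𝒢 n} → List (Constraint 𝒢 n) → (Fin n → Bool) → ℚ
evalAll []               a = 1ℚ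
evalAll {𝒢} (con g s ∷ cs) a = ConstraintSet.fn 𝒢 g (λ j → a (s j)) * evalAll cs a

sumAll : (m : ℕ) → ((Fin m → Bool) → ℚ) → ℚ
sumAll zero    F = F (λ ())
sumAll (suc m) F = sumAll m (λ y → F (λ { zero → false ; (suc i) → y i }))
                 + sumAll m (λ y → F (λ { zero → true  ; (suc i) → y i }))

-- f ≤^acyc_con 𝒢 : variables are x_1..x_k (indices Fin k, first) and
-- y_1..y_m (the remaining indices of Fin (k + m)).
_≤acyc_ : ∀ {k} → Fn k → ConstraintSet → Set
_≤acyc_ {k} f 𝒢 =
  Σ ℚ λ c → c ≢ 0ℚ ×
  Σ ℕ λ m → Σ (List (Constraint 𝒢 (k ℕ.+ m))) λ cs →
    Acyclic (hypergraphOf cs) ×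
    (∀ (x : Fin k → Bool) → f x ≡ c * sumAll m (λ y → evalAll cs (x ++ y)))

data G₀ : Set where
  or₂ xor u₀ : G₀

G₀-arity : G₀ → ℕ
G₀-arity or₂ = 2
G₀-arity xor = 2
G₀-arity u₀  = 1

G₀-fn : (i : G₀) → Fn (G₀-arity i)
G₀-fn or₂ = OR 2
G₀-fn xor = XOR
G₀-fn u₀  = u0

OR2-XOR-u0 : ConstraintSet
OR2-XOR-u0 = record { Idx = G₀ ; arity = G₀-arity ; fn = G₀-fn }

module Submission where

-- Give the inputs w₁ … w_k a common neighbour c, constrained by OR₂(wᵢ, c) for every i and by u₀(c).
-- At c = 1 every OR₂ is 1 and u₀ contributes −1; at c = 0 the product is 1 exactly when all wᵢ = 1.
-- Summing over c therefore gives [w = 1…1] − 1 = −NAND_k(w). Since OR_k(x) = NAND_k(¬x), the OR gadget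
-- first links every input xᵢ to a fresh zᵢ by XOR(xᵢ, zᵢ), which makes the sum over zᵢ pick zᵢ = ¬xᵢ,
-- and then puts the NAND gadget on the zᵢ. Both hypergraphs are trees, so their edges can be deleted one
-- at a time, each through a vertex lying in no later edge, the remainder being empty or inside a later edge.

open import Defs
open import Data.Nat as ℕ using (ℕ; _≤_; zero; suc; z≤n; s≤s; _≡ᵇ_)
import Data.Nat.Properties as ℕ
open import Data.Product using (_×_; ∃; _,_)
open import Data.Sum using (_⊎_; inj₁; inj₂)
open import Data.Empty using (⊥-elim)
open import Data.Bool using (Bool; true; false; not; if_then_else_)
open import Data.Fin using (Fin; zero; suc; _↑ˡ_; _↑ʳ_; splitAt)
open import Data.Fin.Properties using (0≢1+n; suc-injective; ↑ˡ-injective; ↑ʳ-injective; splitAt-↑ˡ; splitAt-↑ʳ)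
open import Data.Fin.Subset using (Subset; _∈_; _∉_; _⊆_; _─_; _-_; ⊥; ⁅_⁆; ∣_∣; outside)
open import Data.Fin.Subset.Properties
  using (_∈?_; nonempty?; Empty-unique; x∈p⇒∣p-x∣<∣p∣; p─q⊆p; x∈p∧x≢y⇒x∈p-y; ⊆-antisym; ⊆-min; ∈⊤;
         ∉⊥; x∈⁅x⁆; x∈⁅y⁆⇒x≡y; x∈p∪q⁻; x∈p∪q⁺)
open import Data.Vec using (_∷_; here; there)
open import Data.Vec.Functional as Vector using (tail)
open import Data.Vec.Functional.Properties using (lookup-++ˡ; lookup-++ʳ)
open import Data.List using (List; []; _∷_; _++_; length)
open import Data.List.Properties using (filter-none)
open import Data.List.Relation.Unary.All as All using (All; []; _∷_)
import Data.List.Relation.Unary.All.Properties as All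
open import Data.List.Relation.Unary.Any as Any using (Any; here; there)
import Data.List.Relation.Unary.Any.Properties as Any
open import Data.Rational using (ℚ; 0ℚ; 1ℚ; -_; _+_; _*_)
open import Data.Rational.Properties using (*-identityˡ; *-zeroˡ; *-assoc; *-distribˡ-+; +-identityˡ; +-identityʳ)
open import Function using (_∘_)
open import Function.Definitions using (Injective)
open import Relation.Nullary using (yes; no)
open import Relation.Binary.Core using (_Preserves_⟶_)
open import Relation.Binary.PropositionalEquality
open import Relation.Binary.Construct.Closure.ReflexiveTransitive using (Star; ε; _◅_)

x∈p─q⇒x∉q : ∀ {n} {x : Fin n} {p q : Subset n} → x ∈ p ─ q → x ∉ q
x∈p─q⇒x∉q {p = _ ∷ _} {outside ∷ _} here        ()
x∈p─q⇒x∉q {p = _ ∷ _} {_       ∷ _} (there x∈) (there x∈q) = x∈p─q⇒x∉q x∈ x∈q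

x∉p⇒p-x≡p : ∀ {n} {x : Fin n} {p : Subset n} → x ∉ p → p - x ≡ p
x∉p⇒p-x≡p {x = x} {p} x∉p =
  ⊆-antisym (p─q⊆p p ⁅ x ⁆) (λ y∈p → x∈p∧x≢y⇒x∈p-y y∈p λ { refl → x∉p y∈p })

x∈p-y⇒x≢y : ∀ {n} {x y : Fin n} {p : Subset n} → x ∈ p - y → x ≢ y
x∈p-y⇒x≢y {y = y} x∈ refl = x∈p─q⇒x∉q x∈ (x∈⁅x⁆ y)

removeVertex-fresh : ∀ {n} {v : Fin n} {E} → All (v ∉_) E → removeVertex v E ≡ E
removeVertex-fresh []            = refl
removeVertex-fresh (v∉e ∷ v∉E) = cong₂ _∷_ (x∉p⇒p-x≡p v∉e) (removeVertex-fresh v∉E)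

degree-private : ∀ {n} {v : Fin n} e {E} → All (v ∉_) E → degree v (e ∷ E) ≤ 1
degree-private {v = v} e v∉E with v ∈? e | filter-none (v ∈?_) v∉E
... | yes _ | none = s≤s (subst (λ l → length l ≤ 0) (sym none) z≤n)
... | no  _ | none = subst (λ l → length l ≤ 1) (sym none) z≤n

edgeless-acyclic : ∀ {n} (V : Subset n) → Acyclic (hg V [])
edgeless-acyclic V = remove ∣ V ∣ V ℕ.≤-refl
  where
  remove : ∀ bound V → ∣ V ∣ ≤ bound → Acyclic (hg V [])
  remove bound V _ with nonempty? V
  remove bound   V _     | no  V-empty = subst (λ W → Acyclic (hg W [])) (sym (Empty-unique V-empty)) ε
  remove zero    V ∣V∣≤0 | yes (v , v∈V) = ⊥-elim (ℕ.n≮0 (ℕ.<-≤-trans (x∈p⇒∣p-x∣<∣p∣ v∈V) ∣V∣≤0))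
  remove (suc b) V ∣V∣≤  | yes (v , v∈V) =
    delVertex v v∈V z≤n ◅
    remove b (V - v) (ℕ.≤-pred (ℕ.<-≤-trans (x∈p⇒∣p-x∣<∣p∣ v∈V) ∣V∣≤))

data Peelable {n : ℕ} : List (Subset n) → Set where
  []   : Peelable []
  peel : ∀ {e E} (v : Fin n) → v ∈ e → All (v ∉_) E →
         e - v ≡ ⊥ ⊎ Any (e - v ⊆_) E → Peelable E → Peelable (e ∷ E)

peelable⇒acyclic : ∀ {n} {V : Subset n} {E} → Peelable E → All (_⊆ V) E → Acyclic (hg V E)
peelable⇒acyclic {V = V} [] [] = edgeless-acyclic V
peelable⇒acyclic {V = V} (peel {e} {E} v v∈e v∉E residue P) (e⊆V ∷ E⊆V) =
  delVertex v (e⊆V v∈e) (degree-private e v∉E) ◅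
  subst (λ E′ → Star Step (hg (V - v) ((e - v) ∷ E′)) (hg ⊥ [])) (sym (removeVertex-fresh v∉E))
    (deleteResidue residue ◅ peelable⇒acyclic P (All.zipWith shrink (E⊆V , v∉E)))
  where
  deleteResidue : e - v ≡ ⊥ ⊎ Any (e - v ⊆_) E → Step (hg (V - v) ((e - v) ∷ E)) (hg (V - v) E)
  deleteResidue (inj₁ e-v≡⊥) = delEmpty zero e-v≡⊥
  deleteResidue (inj₂ e-v⊆) = delSub zero (suc (Any.index e-v⊆)) (λ ()) (Any.lookup-index e-v⊆)
  shrink : ∀ {f} → f ⊆ V × v ∉ f → f ⊆ V - v
  shrink (f⊆V , v∉f) x∈f = x∈p∧x≢y⇒x∈p-y (f⊆V x∈f) λ { refl → v∉f x∈f }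

hypergraphOf-acyclic : ∀ {𝒢 n} {cs : List (Constraint 𝒢 n)} →
                       Peelable (hyperedges cs) → Acyclic (hypergraphOf cs)
hypergraphOf-acyclic P = peelable⇒acyclic P (All.universal (λ _ {_} _ → ∈⊤) _)

module _ {n : ℕ} where

  ∈-scopeSet⁺ : ∀ {d} (s : Fin d → Fin n) j → s j ∈ scopeSet s
  ∈-scopeSet⁺ s zero    = x∈p∪q⁺ (inj₁ (x∈⁅x⁆ (s zero)))
  ∈-scopeSet⁺ s (suc j) = x∈p∪q⁺ (inj₂ (∈-scopeSet⁺ (λ i → s (suc i)) j))

  ∈-scopeSet⁻ : ∀ {d} (s : Fin d → Fin n) {x} → x ∈ scopeSet s → ∃ λ j → x ≡ s j
  ∈-scopeSet⁻ {zero}  s x∈ = ⊥-elim (∉⊥ x∈)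
  ∈-scopeSet⁻ {suc d} s x∈ with x∈p∪q⁻ ⁅ s zero ⁆ _ x∈
  ... | inj₁ x∈⁅s₀⁆ = zero , x∈⁅y⁆⇒x≡y (s zero) x∈⁅s₀⁆
  ... | inj₂ x∈rest with ∈-scopeSet⁻ (λ i → s (suc i)) x∈rest
  ...   | j , x≡sj = suc j , x≡sj

  ∉-scopeSet : ∀ {d} (s : Fin d → Fin n) {x} → (∀ j → x ≢ s j) → x ∉ scopeSet s
  ∉-scopeSet s x≢s x∈ with ∈-scopeSet⁻ s x∈
  ... | j , x≡sj = x≢s j x≡sj

  scopeSet-residue : ∀ {d} (s : Fin d → Fin n) {v e} → (∀ j → s j ≢ v → s j ∈ e) →
                     scopeSet s - v ⊆ e
  scopeSet-residue s absorbs {x} x∈ with ∈-scopeSet⁻ s (p─q⊆p _ _ x∈)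
  ... | j , refl = absorbs j (x∈p-y⇒x≢y x∈)

hyperedges-++ : ∀ {𝒢 n} (cs ds : List (Constraint 𝒢 n)) →
                hyperedges (cs ++ ds) ≡ hyperedges cs ++ hyperedges ds
hyperedges-++ []             ds = refl
hyperedges-++ (con g s ∷ cs) ds = cong (scopeSet s ∷_) (hyperedges-++ cs ds)

single : ∀ {A : Set} → A → Fin 1 → A
single a _ = a

pair : ∀ {A : Set} → A → A → Fin 2 → A
pair a b zero    = a
pair a b (suc _) = b

module _ {N : ℕ} where

  nandGadget : ∀ {k} → (Fin k → Fin N) → Fin N → List (Constraint OR2-XOR-u0 N)
  nandGadget {zero}  w c = con u₀ (single c) ∷ []
  nandGadget {suc k} w c = con or₂ (pair (w zero) c) ∷ nandGadget (tail w) c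

  xorLinks : ∀ {k} → (Fin k → Fin N) → (Fin k → Fin N) → List (Constraint OR2-XOR-u0 N)
  xorLinks {zero}  x z = []
  xorLinks {suc k} x z = con xor (pair (x zero) (z zero)) ∷ xorLinks (tail x) (tail z)

  orGadget : ∀ {k} → (Fin k → Fin N) → (Fin k → Fin N) → Fin N → List (Constraint OR2-XOR-u0 N)
  orGadget x z c = xorLinks x z ++ nandGadget z c

  ∉-pair : ∀ {a b v : Fin N} → v ≢ a → v ≢ b → v ∉ scopeSet (pair a b)
  ∉-pair v≢a v≢b = ∉-scopeSet (pair _ _) λ { zero → v≢a ; (suc zero) → v≢b }

  pair-residue : ∀ {a b : Fin N} {e} → b ∈ e → scopeSet (pair a b) - a ⊆ e
  pair-residue b∈e = scopeSet-residue (pair _ _) λ { zero a≢a → ⊥-elim (a≢a refl) ; (suc zero) _ → b∈e }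

  singleton-residue : ∀ {c : Fin N} → scopeSet (single c) - c ≡ ⊥
  singleton-residue {c} =
    ⊆-antisym (scopeSet-residue (single c) λ { zero c≢c → ⊥-elim (c≢c refl) }) (⊆-min _)

  nandGadget-avoids : ∀ {k} (w : Fin k → Fin N) c {v} → (∀ i → v ≢ w i) → v ≢ c →
                      All (v ∉_) (hyperedges (nandGadget w c))
  nandGadget-avoids {zero}  w c v≢w v≢c = ∉-scopeSet (single c) (λ _ → v≢c) ∷ []
  nandGadget-avoids {suc k} w c v≢w v≢c =
    ∉-pair (v≢w zero) v≢c ∷ nandGadget-avoids (tail w) c (λ i → v≢w (suc i)) v≢c

  xorLinks-avoids : ∀ {k} (x z : Fin k → Fin N) {v} → (∀ i → v ≢ x i) → (∀ i → v ≢ z i) →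
                    All (v ∉_) (hyperedges (xorLinks x z))
  xorLinks-avoids {zero}  x z v≢x v≢z = []
  xorLinks-avoids {suc k} x z v≢x v≢z =
    ∉-pair (v≢x zero) (v≢z zero) ∷
    xorLinks-avoids (tail x) (tail z) (λ i → v≢x (suc i)) (λ i → v≢z (suc i))

  nandGadget-centre : ∀ {k} (w : Fin k → Fin N) c → Any (c ∈_) (hyperedges (nandGadget w c))
  nandGadget-centre {zero}  w c = here (∈-scopeSet⁺ (single c) zero)
  nandGadget-centre {suc k} w c = here (∈-scopeSet⁺ (pair (w zero) c) (suc zero))

  nandGadget-leaf : ∀ {k} (w : Fin k → Fin N) c i → Any (w i ∈_) (hyperedges (nandGadget w c))
  nandGadget-leaf w c zero    = here (∈-scopeSet⁺ (pair (w zero) c) zero)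
  nandGadget-leaf w c (suc i) = there (nandGadget-leaf (tail w) c i)

  nandGadget-peelable : ∀ {k} (w : Fin k → Fin N) c → Injective _≡_ _≡_ w → (∀ i → w i ≢ c) →
                        Peelable (hyperedges (nandGadget w c))
  nandGadget-peelable {zero}  w c _ _ = peel c (∈-scopeSet⁺ (single c) zero) [] (inj₁ singleton-residue) []
  nandGadget-peelable {suc k} w c w-inj w≢c =
    peel (w zero) (∈-scopeSet⁺ (pair (w zero) c) zero)
         (nandGadget-avoids (tail w) c (λ i eq → 0≢1+n (w-inj eq)) (w≢c zero))
         (inj₂ (Any.map pair-residue (nandGadget-centre (tail w) c)))
         (nandGadget-peelable (tail w) c (λ eq → suc-injective (w-inj eq)) (λ i → w≢c (suc i)))

  xorLinks-peelable : ∀ {k} (x z : Fin k → Fin N) {E} → Injective _≡_ _≡_ x → (∀ i j → x i ≢ z j) →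
                      (∀ i → All (x i ∉_) E) → (∀ i → Any (z i ∈_) E) → Peelable E →
                      Peelable (hyperedges (xorLinks x z) ++ E)
  xorLinks-peelable {zero}  x z _ _ _ _ P = P
  xorLinks-peelable {suc k} x z x-inj x≢z x∉E z∈E P =
    peel (x zero) (∈-scopeSet⁺ (pair (x zero) (z zero)) zero)
         (All.++⁺ (xorLinks-avoids (tail x) (tail z) (λ i eq → 0≢1+n (x-inj eq)) (λ i → x≢z zero (suc i)))
                  (x∉E zero))
         (inj₂ (Any.++⁺ʳ (hyperedges (xorLinks (tail x) (tail z))) (Any.map pair-residue (z∈E zero))))
         (xorLinks-peelable (tail x) (tail z) (λ eq → suc-injective (x-inj eq)) (λ i j → x≢z (suc i) (suc j))
                            (λ i → x∉E (suc i)) (λ i → z∈E (suc i)) P)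

  orGadget-peelable : ∀ {k} (x z : Fin k → Fin N) c → Injective _≡_ _≡_ x → Injective _≡_ _≡_ z →
                      (∀ i j → x i ≢ z j) → (∀ i → x i ≢ c) → (∀ i → z i ≢ c) →
                      Peelable (hyperedges (orGadget x z c))
  orGadget-peelable x z c x-inj z-inj x≢z x≢c z≢c =
    subst Peelable (sym (hyperedges-++ (xorLinks x z) (nandGadget z c)))
      (xorLinks-peelable x z x-inj x≢z (λ i → nandGadget-avoids z c (x≢z i) (x≢c i))
                         (nandGadget-leaf z c) (nandGadget-peelable z c z-inj z≢c))

sumAll-cong : ∀ m {F G : (Fin m → Bool) → ℚ} → (∀ y → F y ≡ G y) → sumAll m F ≡ sumAll m G
sumAll-cong zero    F≡G = F≡G _
sumAll-cong (suc m) F≡G = cong₂ _+_ (sumAll-cong m λ _ → F≡G _) (sumAll-cong m λ _ → F≡G _)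

sumAll-scale : ∀ m c (F : (Fin m → Bool) → ℚ) → sumAll m (λ y → c * F y) ≡ c * sumAll m F
sumAll-scale zero    c F = refl
sumAll-scale (suc m) c F =
  trans (cong₂ _+_ (sumAll-scale m c _) (sumAll-scale m c _)) (sym (*-distribˡ-+ c _ _))

sumAll-suc : ∀ m (F : (Fin (suc m) → Bool) → ℚ) → F Preserves _≗_ ⟶ _≡_ →
             sumAll (suc m) F ≡ sumAll m (λ y → F (false Vector.∷ y)) + sumAll m (λ y → F (true Vector.∷ y))
sumAll-suc m F F-cong = cong₂ _+_ (sumAll-cong m λ _ → F-cong λ { zero → refl ; (suc _) → refl })
                                  (sumAll-cong m λ _ → F-cong λ { zero → refl ; (suc _) → refl })

evalAll-++ : ∀ {𝒢 n} (cs ds : List (Constraint 𝒢 n)) α →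
             evalAll (cs ++ ds) α ≡ evalAll cs α * evalAll ds α
evalAll-++ []             ds α = sym (*-identityˡ _)
evalAll-++ {𝒢} (con g s ∷ cs) ds α =
  trans (cong (fg *_) (evalAll-++ cs ds α)) (sym (*-assoc fg (evalAll cs α) (evalAll ds α)))
  where fg = ConstraintSet.fn 𝒢 g (λ j → α (s j))

ones-cong : ∀ {k} {u v : Fin k → Bool} → u ≗ v → ones u ≡ ones v
ones-cong {zero}  u≗v = refl
ones-cong {suc k} u≗v =
  cong₂ (λ b m → (if b then 1 else 0) ℕ.+ m) (u≗v zero) (ones-cong (λ i → u≗v (suc i)))

ones≤arity : ∀ {k} (u : Fin k → Bool) → ones u ≤ k
ones≤arity {zero}  u = z≤n
ones≤arity {suc k} u with u zero
... | true  = s≤s (ones≤arity (tail u))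
... | false = ℕ.m≤n⇒m≤1+n (ones≤arity (tail u))

m≤n⇒m≡ᵇ1+n≡false : ∀ {m n} → m ≤ n → (m ≡ᵇ suc n) ≡ false
m≤n⇒m≡ᵇ1+n≡false z≤n       = refl
m≤n⇒m≡ᵇ1+n≡false (s≤s m≤n) = m≤n⇒m≡ᵇ1+n≡false m≤n

ones∘not≡ᵇk≡ones≡ᵇ0 : ∀ {k} (u : Fin k → Bool) → (ones (not ∘ u) ≡ᵇ k) ≡ (ones u ≡ᵇ 0)
ones∘not≡ᵇk≡ones≡ᵇ0 {zero}  u = refl
ones∘not≡ᵇk≡ones≡ᵇ0 {suc k} u with u zero
... | false = ones∘not≡ᵇk≡ones≡ᵇ0 (tail u)
... | true  = m≤n⇒m≡ᵇ1+n≡false (ones≤arity (not ∘ tail u))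

NAND∘not≡OR : ∀ k (u : Fin k → Bool) → NAND k (not ∘ u) ≡ OR k u
NAND∘not≡OR k u = cong (λ b → if b then 0ℚ else 1ℚ) (ones∘not≡ᵇk≡ones≡ᵇ0 u)

nandGadgetValue : ∀ k → (Fin k → Bool) → Bool → ℚ
nandGadgetValue k u true  = - 1ℚ
nandGadgetValue k u false = if ones u ≡ᵇ k then 1ℚ else 0ℚ

nandGadgetValue-cong : ∀ k {u v} b → u ≗ v → nandGadgetValue k u b ≡ nandGadgetValue k v b
nandGadgetValue-cong k true  u≗v = refl
nandGadgetValue-cong k false u≗v = cong (λ m → if m ≡ᵇ k then 1ℚ else 0ℚ) (ones-cong u≗v)

nandGadgetValue-suc : ∀ k (u : Fin (suc k) → Bool) b →
                      OR 2 (pair (u zero) b) * nandGadgetValue k (tail u) b ≡ nandGadgetValue (suc k) u b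
nandGadgetValue-suc k u true with u zero
... | true  = refl
... | false = refl
nandGadgetValue-suc k u false with u zero
... | true  = *-identityˡ _
... | false rewrite m≤n⇒m≡ᵇ1+n≡false (ones≤arity (tail u)) = *-zeroˡ (nandGadgetValue k (tail u) false)

nandGadgetValue-sum : ∀ k u → - 1ℚ * (nandGadgetValue k u false + nandGadgetValue k u true) ≡ NAND k u
nandGadgetValue-sum k u with ones u ≡ᵇ k
... | true  = refl
... | false = refl

evalAll-nandGadget : ∀ {N k} (w : Fin k → Fin N) c α {u b} → (∀ i → α (w i) ≡ u i) → α c ≡ b →
                     evalAll (nandGadget w c) α ≡ nandGadgetValue k u b
evalAll-nandGadget {k = zero}  w c α _ refl with α c
... | true  = refl
... | false = refl
evalAll-nandGadget {k = suc k} w c α {u} {b} αw≡u αc≡b =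
  trans (cong₂ _*_ (cong₂ (λ a b → OR 2 (pair a b)) (αw≡u zero) αc≡b)
                   (evalAll-nandGadget (tail w) c α (λ i → αw≡u (suc i)) αc≡b))
        (nandGadgetValue-suc k u b)

xorWeight : ∀ {k} → (Fin k → Bool) → (Fin k → Bool) → ℚ
xorWeight {zero}  u v = 1ℚ
xorWeight {suc k} u v = XOR (pair (u zero) (v zero)) * xorWeight (tail u) (tail v)

xorWeight-congʳ : ∀ {k} (u : Fin k → Bool) {v v′} → v ≗ v′ → xorWeight u v ≡ xorWeight u v′
xorWeight-congʳ {zero}  u v≗v′ = refl
xorWeight-congʳ {suc k} u v≗v′ =
  cong₂ (λ b w → XOR (pair (u zero) b) * w) (v≗v′ zero) (xorWeight-congʳ (tail u) (λ i → v≗v′ (suc i)))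

evalAll-xorLinks : ∀ {N k} (x z : Fin k → Fin N) α {u v} →
                   (∀ i → α (x i) ≡ u i) → (∀ i → α (z i) ≡ v i) →
                   evalAll (xorLinks x z) α ≡ xorWeight u v
evalAll-xorLinks {k = zero}  x z α αx≡u αz≡v = refl
evalAll-xorLinks {k = suc k} x z α αx≡u αz≡v =
  cong₂ _*_ (cong₂ (λ a b → XOR (pair a b)) (αx≡u zero) (αz≡v zero))
            (evalAll-xorLinks (tail x) (tail z) α (λ i → αx≡u (suc i)) (λ i → αz≡v (suc i)))

XOR-select : ∀ a (H : Bool → ℚ) → XOR (pair a false) * H false + XOR (pair a true) * H true ≡ H (not a)
XOR-select true  H = begin
  1ℚ * H false + 0ℚ * H true ≡⟨ cong₂ _+_ (*-identityˡ (H false)) (*-zeroˡ (H true)) ⟩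
  H false + 0ℚ               ≡⟨ +-identityʳ (H false) ⟩
  H false                    ∎
  where open ≡-Reasoning
XOR-select false H = begin
  0ℚ * H false + 1ℚ * H true ≡⟨ cong₂ _+_ (*-zeroˡ (H false)) (*-identityˡ (H true)) ⟩
  0ℚ + H true                ≡⟨ +-identityˡ (H true) ⟩
  H true                     ∎
  where open ≡-Reasoning

sumAll-xorWeight : ∀ k (u : Fin k → Bool) (G : (Fin k → Bool) → ℚ) → G Preserves _≗_ ⟶ _≡_ →
                   sumAll k (λ v → xorWeight u v * G v) ≡ G (not ∘ u)
sumAll-xorWeight zero    u G G-cong = trans (*-identityˡ _) (G-cong λ ())
sumAll-xorWeight (suc k) u G G-cong = begin
  sumAll (suc k) (λ v → xorWeight u v * G v)
    ≡⟨ sumAll-suc k _ (λ v≗v′ → cong₂ _*_ (xorWeight-congʳ u v≗v′) (G-cong v≗v′)) ⟩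
  sumAll k (λ v → xorWeight u (false Vector.∷ v) * G (false Vector.∷ v)) +
  sumAll k (λ v → xorWeight u (true Vector.∷ v) * G (true Vector.∷ v))
    ≡⟨ cong₂ _+_ (firstBit false) (firstBit true) ⟩
  XOR (pair (u zero) false) * H false + XOR (pair (u zero) true) * H true
    ≡⟨ XOR-select (u zero) H ⟩
  H (not (u zero))
    ≡⟨ G-cong (λ { zero → refl ; (suc _) → refl }) ⟩
  G (not ∘ u) ∎
  where
  open ≡-Reasoning
  H : Bool → ℚ
  H b = G (b Vector.∷ (not ∘ tail u))
  firstBit : ∀ b → sumAll k (λ v → xorWeight u (b Vector.∷ v) * G (b Vector.∷ v))
                   ≡ XOR (pair (u zero) b) * H b
  firstBit b = begin
    sumAll k (λ v → (x₀ * xorWeight (tail u) v) * G (b Vector.∷ v))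
      ≡⟨ sumAll-cong k (λ v → *-assoc x₀ _ _) ⟩
    sumAll k (λ v → x₀ * (xorWeight (tail u) v * G (b Vector.∷ v)))
      ≡⟨ sumAll-scale k x₀ _ ⟩
    x₀ * sumAll k (λ v → xorWeight (tail u) v * G (b Vector.∷ v))
      ≡⟨ cong (x₀ *_) (sumAll-xorWeight k (tail u) (G ∘ (b Vector.∷_))
                                          (λ v≗v′ → G-cong λ { zero → refl ; (suc i) → v≗v′ i })) ⟩
    x₀ * H b ∎
    where x₀ = XOR (pair (u zero) b)

↑ˡ≢↑ʳ : ∀ {m n} (i : Fin m) (j : Fin n) → i ↑ˡ n ≢ m ↑ʳ j
↑ˡ≢↑ʳ {m} {n} i j eq with trans (sym (splitAt-↑ˡ m i n)) (trans (cong (splitAt m) eq) (splitAt-↑ʳ m n j))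
... | ()

NAND≤acyc : ∀ k → NAND k ≤acyc OR2-XOR-u0
NAND≤acyc k = - 1ℚ , (λ ()) , 1 , nandGadget leaf centre , acyclic , realises
  where
  leaf : Fin k → Fin (k ℕ.+ 1)
  leaf i = i ↑ˡ 1
  centre : Fin (k ℕ.+ 1)
  centre = k ↑ʳ zero
  acyclic : Acyclic (hypergraphOf (nandGadget leaf centre))
  acyclic = hypergraphOf-acyclic
    (nandGadget-peelable leaf centre (↑ˡ-injective 1 _ _) (λ i → ↑ˡ≢↑ʳ i zero))
  realises : ∀ x → NAND k x ≡ - 1ℚ * sumAll 1 (λ y → evalAll (nandGadget leaf centre) (x Vector.++ y))
  realises x = sym (begin
    - 1ℚ * sumAll 1 (λ y → evalAll (nandGadget leaf centre) (x Vector.++ y))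
      ≡⟨ cong (- 1ℚ *_) (cong₂ _+_ (evaluate _) (evaluate _)) ⟩
    - 1ℚ * (nandGadgetValue k x false + nandGadgetValue k x true)
      ≡⟨ nandGadgetValue-sum k x ⟩
    NAND k x ∎)
    where
    open ≡-Reasoning
    evaluate : ∀ y → evalAll (nandGadget leaf centre) (x Vector.++ y) ≡ nandGadgetValue k x (y zero)
    evaluate y = evalAll-nandGadget leaf centre _ (lookup-++ˡ x y) (lookup-++ʳ x y zero)

OR≤acyc : ∀ k → OR k ≤acyc OR2-XOR-u0
OR≤acyc k = - 1ℚ , (λ ()) , suc k , orGadget input negated centre , acyclic , realises
  where
  input negated : Fin k → Fin (k ℕ.+ suc k)
  input i   = i ↑ˡ suc k
  negated i = k ↑ʳ suc i
  centre : Fin (k ℕ.+ suc k)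
  centre = k ↑ʳ zero
  acyclic : Acyclic (hypergraphOf (orGadget input negated centre))
  acyclic = hypergraphOf-acyclic
    (orGadget-peelable input negated centre (↑ˡ-injective (suc k) _ _)
                       (λ eq → suc-injective (↑ʳ-injective k _ _ eq))
                       (λ i j → ↑ˡ≢↑ʳ i (suc j)) (λ i → ↑ˡ≢↑ʳ i zero)
                       (λ i eq → 0≢1+n (sym (↑ʳ-injective k _ _ eq))))
  realises : ∀ x → OR k x
                   ≡ - 1ℚ * sumAll (suc k) (λ y → evalAll (orGadget input negated centre) (x Vector.++ y))
  realises x = sym (begin
    - 1ℚ * sumAll (suc k) (λ y → evalAll (orGadget input negated centre) (x Vector.++ y))
      -- sumAll (suc k) splits first on the centre, the first auxiliary variable.
      ≡⟨ cong (- 1ℚ *_) (sumAll-cong (suc k) evaluate) ⟩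
    - 1ℚ * (sumAll k (λ z → xorWeight x z * nandGadgetValue k z false) +
            sumAll k (λ z → xorWeight x z * nandGadgetValue k z true))
      ≡⟨ cong (- 1ℚ *_) (cong₂ _+_ (sumAll-xorWeight k x _ (nandGadgetValue-cong k false))
                                   (sumAll-xorWeight k x _ (nandGadgetValue-cong k true))) ⟩
    - 1ℚ * (nandGadgetValue k (not ∘ x) false + nandGadgetValue k (not ∘ x) true)
      ≡⟨ nandGadgetValue-sum k (not ∘ x) ⟩
    NAND k (not ∘ x)
      ≡⟨ NAND∘not≡OR k x ⟩
    OR k x ∎)
    where
    open ≡-Reasoning
    evaluate : ∀ y → evalAll (orGadget input negated centre) (x Vector.++ y)
                     ≡ xorWeight x (tail y) * nandGadgetValue k (tail y) (y zero)
    evaluate y = trans (evalAll-++ (xorLinks input negated) (nandGadget negated centre) _)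
      (cong₂ _*_ (evalAll-xorLinks input negated _ (lookup-++ˡ x y) (λ i → lookup-++ʳ x y (suc i)))
                 (evalAll-nandGadget negated centre _ (λ i → lookup-++ʳ x y (suc i)) (lookup-++ʳ x y zero)))

-- The gadgets work for every arity.
corollary3p6 : ((k : ℕ) → 4 ≤ k → OR k ≤acyc OR2-XOR-u0)
               × ((k : ℕ) → 2 ≤ k → NAND k ≤acyc OR2-XOR-u0)
corollary3p6 = (λ k _ → OR≤acyc k) , (λ k _ → NAND≤acyc k)
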